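{- For every integer $n\geq 0$, in the Tower of Hanoi-Fibonacci with $n$ disks there is a finite sequence of Fibonacci moves leading from the state $(\Delta_n,\varnothing,\varnothing)$ to the state $(\varnothing,\varnothing,\Delta_n)$. The minimal number of Fibonacci moves in such a sequence is exactly $F_{n+2}-1$ (so a minimal solution passes through $F_{n+2}$ distinct states), and there is exactly one sequence of moves achieving this minimum.
   Context: Fibonacci numbers: $F_1=F_2=1$, $F_{m+2}=F_{m+1}+F_m$. Disks are labelled $1,\dots,n$ by radius; $\Delta_k=\{1,\dots,k\}$ (and $\Delta_k=\varnothing$ for $k<1$). A state is an ordered triple $(A,B,C)$ of pairwise disjoint sets with union $\Delta_n$ (pegs $A,B,C$; each peg holds its disks in decreasing order from bottom to top, so the top disk of a peg is its minimum). For a set $S$ of disks and a disk $k$, writing $kS$ (or $\Delta_{k-1}S$) means the peg contains $k$ (resp. $\Delta_{k-1}$) together with $S$, all elements of $S$ being larger. For $k\in\Delta_n$, a $k$-Fibonacci move is defined when two distinct pegs $X,Y$ satisfy $X=k\tilde X$ and $Y=\Delta_{k-1}\tilde Y$ (with all disks of $\tilde X,\tilde Y$ larger than $k$) and the third peg $Z$ contains only disks larger than $k$; it puts both disks $k-1$ and $k$ simultaneously onto $Z$: $k\tilde{X}\sqcup \Delta_{k-1}\tilde{Y}\sqcup Z\longrightarrow \tilde{X}\sqcup \Delta_{k-2}\tilde{Y}\sqcup (k-1)kZ$ (positions of pegs preserved). For $k=1$ this just moves disk $1$ to another peg. A Fibonacci move is a $k$-Fibonacci move for some $k$; the Tower of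 Hanoi-Fibonacci is the puzzle where only Fibonacci moves are allowed. -}

module Defs where

open import Data.Nat using (ℕ; zero; suc; _+_; _∸_; _≤_; _<_)
open import Data.Fin using (Fin; toℕ) renaming (zero to fzero; suc to fsuc)
open import Data.Vec using (Vec; lookup; replicate)
open import Data.List using (List; []; _∷_; length)
open import Data.Product using (Σ; _×_)
open import Data.Sum using (_⊎_)
open import Relation.Binary.PropositionalEquality using (_≡_; _≢_)

fib : ℕ → ℕ
fib zero = zero
fib (suc zero) = suc zero
fib (suc (suc m)) = fib (suc m) + fib m

Peg : Set
Peg = Fin 3

pegA pegC : Peg
pegA = fzero
pegC = fsuc (fsuc fzero)

-- Disks 1..n are represented by Fin n: the element i stands for disk (toℕ i + 1),
-- so comparison of disks by radius is comparison of toℕ.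
-- A state (A,B,C) of disjoint sets with union Δ_n is a function assigning
-- each disk its peg (the order on a peg is forced: decreasing from the bottom).
State : ℕ → Set
State n = Vec Peg n

-- A move label: a k-Fibonacci move from peg X, with Δ_{k-1} on peg Y,
-- putting disks k-1 and k onto the third peg Z.
record Move (n : ℕ) : Set where
  constructor move
  field
    disk : Fin n
    X Y Z : Peg

FibStep : {n : ℕ} → State n → Move n → State n → Set
FibStep {n} s (move k X Y Z) t =
  X ≢ Y × X ≢ Z × Y ≢ Z ×
  lookup s k ≡ X ×
  (∀ (j : Fin n) → lookup s j ≡ X → toℕ k ≤ toℕ j) ×
  (∀ (j : Fin n) → toℕ j < toℕ k → lookup s j ≡ Y) ×
  (∀ (j : Fin n) → lookup s j ≡ Z → toℕ k < toℕ j) ×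
  -- result: disks k and k-1 (if k ≥ 2) are now on Z, all other disks stay
  (∀ (j : Fin n) → (toℕ j ≡ toℕ k ⊎ suc (toℕ j) ≡ toℕ k) → lookup t j ≡ Z) ×
  (∀ (j : Fin n) → toℕ j ≢ toℕ k → suc (toℕ j) ≢ toℕ k → lookup t j ≡ lookup s j)

Reaches : {n : ℕ} → State n → List (Move n) → State n → Set
Reaches s [] t = s ≡ t
Reaches {n} s (m ∷ ms) t = Σ (State n) (λ u → FibStep s m u × Reaches u ms t)

start : (n : ℕ) → State n
start n = replicate n pegA

goal : (n : ℕ) → State n
goal n = replicate n pegC

-- Read a state from its largest disk down and define a potential cost s P for reaching the
-- tower on peg P by the recursion of the best strategy: the largest misplaced disk moves either
-- once or twice.  A Fibonacci move lowers the potential by at most one, so it bounds the length of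
-- every solution, and on a tower standing on another peg it equals F (m + 2) − 1.  Call a
-- configuration direct when, at every level, moving the largest misplaced disk once is strictly
-- cheaper.  The start tower is direct, and from a direct configuration exactly one move lowers the
-- potential, always to a direct configuration.  Hence the solutions of length F (n + 2) − 1 are
-- exactly the chains of these forced moves, and there is one.

module Submission where

open import Defs
open import Data.Nat using (ℕ; zero; suc; _+_; _∸_; _≤_; _<_; _⊓_; z≤n; s≤s; _<?_)
open import Data.Nat.Properties
open import Data.Fin using (Fin; toℕ; fromℕ<) renaming (zero to fzero; suc to fsuc)
open import Data.Fin.Properties using (all?; toℕ<n; toℕ-fromℕ<; toℕ-injective)
  renaming (_≟_ to _≟ₚ_)
open import Data.Vec using (Vec; []; _∷_; lookup; replicate; tabulate)
open import Data.Vec.Properties using (lookup∘tabulate; tabulate∘lookup; tabulate-cong; lookup-replicate)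
open import Data.List using (List; []; _∷_; length)
open import Function using (_∘_)
open import Data.Product using (Σ; ∃; ∃₂; _×_; _,_; proj₁; proj₂)
open import Data.Product.Properties using (,-injectiveˡ; ,-injectiveʳ)
open import Data.Sum using (_⊎_; inj₁; inj₂)
open import Data.Unit using (⊤; tt)
open import Data.Empty using (⊥-elim)
open import Relation.Nullary using (yes; no; ¬?)
open import Relation.Nullary.Decidable using (from-yes; _→-dec_; _⊎-dec_)
open import Relation.Binary.PropositionalEquality

pattern pA = fzero
pattern pB = fsuc fzero
pattern pC = fsuc (fsuc fzero)

-- Junk value X when X ≡ Y.
third : Peg → Peg → Peg
third pA pB = pC
third pA pC = pB
third pB pA = pC
third pB pC = pA
third pC pA = pB
third pC pB = pA
third X _ = X

≢-third : ∀ X Y → X ≢ Y → X ≢ third X Y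
≢-third = from-yes (all? λ X → all? λ Y → ¬? (X ≟ₚ Y) →-dec ¬? (X ≟ₚ third X Y))

third-≢ : ∀ X Y → X ≢ Y → third X Y ≢ Y
third-≢ = from-yes (all? λ X → all? λ Y → ¬? (X ≟ₚ Y) →-dec ¬? (third X Y ≟ₚ Y))

third-unique : ∀ X Y Z → X ≢ Y → X ≢ Z → Y ≢ Z → third X Y ≡ Z
third-unique = from-yes (all? λ X → all? λ Y → all? λ Z →
  ¬? (X ≟ₚ Y) →-dec ¬? (X ≟ₚ Z) →-dec ¬? (Y ≟ₚ Z) →-dec third X Y ≟ₚ Z)

peg-cases : ∀ (X Y Z P : Peg) → X ≢ Y → X ≢ Z → Y ≢ Z → P ≡ X ⊎ P ≡ Y ⊎ P ≡ Z
peg-cases = from-yes (all? λ (X : Peg) → all? λ (Y : Peg) → all? λ (Z : Peg) → all? λ (P : Peg) →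
  ¬? (X ≟ₚ Y) →-dec ¬? (X ≟ₚ Z) →-dec ¬? (Y ≟ₚ Z) →-dec
  ((P ≟ₚ X) ⊎-dec (P ≟ₚ Y) ⊎-dec (P ≟ₚ Z)))

-- Disks 1, …, m listed from the largest down (whereas Defs.State lists from the smallest).
infixr 5 _◂_
data Conf : ℕ → Set where
  []  : Conf 0
  _◂_ : ∀ {m} → Peg → Conf m → Conf (suc m)

tower : ∀ m → Peg → Conf m
tower zero    Y = []
tower (suc m) Y = Y ◂ tower m Y

-- If the largest disk x is off P, the better of two routes: x moves once, after the smaller
-- disks gather on the third peg (one move then brings x and its neighbour to P, and a tower of
-- F (m + 1) − 1 moves finishes), or x moves twice, via the third peg.
cost : ∀ {m} → Conf m → Peg → ℕ
costOnce : ∀ {m} → Conf m → Peg → Peg → ℕ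
costTwice : ∀ {m} → Conf m → Peg → ℕ

cost [] P = 0
cost (x ◂ s) P with x ≟ₚ P
... | yes _ = cost s P
... | no _  = costOnce s x P ⊓ costTwice s P

costOnce {m} s x P = cost s (third x P) + fib (1 + m)
costTwice {m} s P = suc (cost s P + fib (2 + m))

cost-here : ∀ {m} x (s : Conf m) → cost (x ◂ s) x ≡ cost s x
cost-here x s with x ≟ₚ x
... | yes _ = refl
... | no x≢x = ⊥-elim (x≢x refl)

cost-away : ∀ {m} {x P} (s : Conf m) → x ≢ P → cost (x ◂ s) P ≡ costOnce s x P ⊓ costTwice s P
cost-away {x = x} {P} s x≢P with x ≟ₚ P
... | yes x≡P = ⊥-elim (x≢P x≡P)
... | no _    = refl

fib-mono : ∀ m → fib (1 + m) ≤ fib (2 + m)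
fib-mono m = m≤m+n (fib (1 + m)) (fib m)

0<fib-suc : ∀ m → 0 < fib (1 + m)
0<fib-suc zero    = s≤s z≤n
0<fib-suc (suc m) = ≤-trans (0<fib-suc m) (fib-mono m)

once<twice : ∀ m c → c + fib (1 + m) < suc (c + fib (2 + m))
once<twice m c = s≤s (+-monoʳ-≤ c (fib-mono m))

cost-away-≥ : ∀ {m} {x P} (s : Conf m) → x ≢ P → fib (1 + m) ≤ cost (x ◂ s) P
cost-away-≥ {m} {x} {P} s x≢P rewrite cost-away s x≢P =
  ⊓-glb (m≤n+m (fib (1 + m)) (cost s (third x P)))
        (≤-trans (fib-mono m) (m≤n⇒m≤1+n (m≤n+m (fib (2 + m)) (cost s P))))

cost-twice-away-≥ : ∀ {m} {x P} (s : Conf m) → x ≢ P → fib (3 + m) ≤ cost (x ◂ x ◂ s) P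
cost-twice-away-≥ {m} {x} {P} s x≢P rewrite cost-away (x ◂ s) x≢P =
  ⊓-glb once-≥ (m≤n⇒m≤1+n (m≤n+m (fib (3 + m)) (cost (x ◂ s) P)))
  where
  once-≥ : fib (3 + m) ≤ cost (x ◂ s) (third x P) + fib (2 + m)
  once-≥ = subst (_≤ cost (x ◂ s) (third x P) + fib (2 + m)) (+-comm (fib (1 + m)) (fib (2 + m)))
             (+-monoˡ-≤ (fib (2 + m)) (cost-away-≥ s (≢-third x P x≢P)))

cost-tower-here : ∀ m Y → cost (tower m Y) Y ≡ 0
cost-tower-here zero    Y = refl
cost-tower-here (suc m) Y = trans (cost-here Y (tower m Y)) (cost-tower-here m Y)

cost-tower-away : ∀ m {Y P} → Y ≢ P → suc (cost (tower m Y) P) ≡ fib (2 + m)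
tower-once<twice : ∀ m {Y P} → Y ≢ P → costOnce (tower m Y) Y P < costTwice (tower m Y) P

cost-tower-away zero    Y≢P = refl
cost-tower-away (suc m) {Y} {P} Y≢P = begin
  suc (cost (Y ◂ tower m Y) P)
    ≡⟨ cong suc (cost-away (tower m Y) Y≢P) ⟩
  suc (costOnce (tower m Y) Y P ⊓ costTwice (tower m Y) P)
    ≡⟨ cong suc (m≤n⇒m⊓n≡m (<⇒≤ (tower-once<twice m Y≢P))) ⟩
  suc (cost (tower m Y) (third Y P)) + fib (1 + m)
    ≡⟨ cong (_+ fib (1 + m)) (cost-tower-away m (≢-third Y P Y≢P)) ⟩
  fib (2 + m) + fib (1 + m)
    ∎
  where open ≡-Reasoning

tower-once<twice m {Y} {P} Y≢P =
  subst (λ c → c + fib (1 + m) < costTwice (tower m Y) P) (sym same-cost) (once<twice m (cost (tower m Y) P))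
  where
  same-cost : cost (tower m Y) (third Y P) ≡ cost (tower m Y) P
  same-cost = suc-injective (trans (cost-tower-away m (≢-third Y P Y≢P)) (sym (cost-tower-away m Y≢P)))

tower-of-cost-zero : ∀ {m} (s : Conf m) P → cost s P ≡ 0 → s ≡ tower m P
tower-of-cost-zero [] P _ = refl
tower-of-cost-zero {suc m} (x ◂ s) P c≡0 with x ≟ₚ P
... | yes refl = cong (x ◂_) (tower-of-cost-zero s P c≡0)
... | no _     = ⊥-elim (<⇒≢ (⊓-glb (≤-trans (0<fib-suc m) (m≤n+m _ _)) (s≤s z≤n)) (sym c≡0))

-- Step s (k , Z) t : a Fibonacci move of disk k + 1 onto peg Z.
data Step : ∀ {m} → Conf m → ℕ × Peg → Conf m → Set where
  below  : ∀ {m} {s t : Conf m} {kZ} x → Step s kZ t → Step (x ◂ s) kZ (x ◂ t)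
  single : ∀ {X Z} → X ≢ Z → Step (X ◂ []) (0 , Z) (Z ◂ [])
  pair   : ∀ {X Y Z} j → X ≢ Y → X ≢ Z → Y ≢ Z →
           Step (X ◂ Y ◂ tower j Y) (suc j , Z) (Z ◂ Z ◂ tower j Y)

pair-cost-X : ∀ j {X Y Z} → X ≢ Y → X ≢ Z →
              cost (X ◂ Y ◂ tower j Y) X < cost (Z ◂ Z ◂ tower j Y) X
pair-cost-X j {X} {Y} {Z} X≢Y X≢Z = begin-strict
  cost (X ◂ Y ◂ tower j Y) X      ≡⟨ cost-here X (Y ◂ tower j Y) ⟩
  cost (tower (suc j) Y) X        <⟨ n<1+n _ ⟩
  suc (cost (tower (suc j) Y) X)  ≡⟨ cost-tower-away (suc j) (≢-sym X≢Y) ⟩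
  fib (3 + j)                     ≤⟨ cost-twice-away-≥ (tower j Y) (≢-sym X≢Z) ⟩
  cost (Z ◂ Z ◂ tower j Y) X      ∎
  where open ≤-Reasoning

pair-costTwice-Y : ∀ j Y → costTwice (Y ◂ tower j Y) Y ≡ suc (fib (3 + j))
pair-costTwice-Y j Y = cong (λ c → suc (c + fib (3 + j))) (cost-tower-here (suc j) Y)

pair-costOnce-Z : ∀ j {X Y Z} → X ≢ Y → X ≢ Z → Y ≢ Z → costOnce (Y ◂ tower j Y) X Z ≡ fib (2 + j)
pair-costOnce-Z j {X} {Y} {Z} X≢Y X≢Z Y≢Z
  rewrite third-unique X Z Y X≢Z X≢Y (≢-sym Y≢Z) | cost-tower-here (suc j) Y = refl

pair-cost-Z : ∀ j {Y Z} → Y ≢ Z → suc (cost (Z ◂ Z ◂ tower j Y) Z) ≡ fib (2 + j)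
pair-cost-Z j {Y} {Z} Y≢Z
  rewrite cost-here Z (Z ◂ tower j Y) | cost-here Z (tower j Y) = cost-tower-away j Y≢Z

cost-step : ∀ {m} {s t : Conf m} {kZ} → Step s kZ t → ∀ P → cost s P ≤ suc (cost t P)
cost-step (below x st) P with x ≟ₚ P
... | yes _ = cost-step st P
... | no _  = ⊓-mono-≤ (+-monoˡ-≤ _ (cost-step st (third x P))) (s≤s (+-monoˡ-≤ _ (cost-step st P)))
cost-step (single {X} _) P with X ≟ₚ P
... | yes _ = z≤n
... | no _  = s≤s z≤n
cost-step (pair {X} {Y} {Z} j X≢Y X≢Z Y≢Z) P with peg-cases X Y Z P X≢Y X≢Z Y≢Z
... | inj₁ refl        = m<n⇒m≤1+n (pair-cost-X j X≢Y X≢Z)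
... | inj₂ (inj₁ refl) = begin
  cost (X ◂ Y ◂ tower j Y) Y      ≡⟨ cost-away (Y ◂ tower j Y) X≢Y ⟩
  _ ⊓ costTwice (Y ◂ tower j Y) Y ≤⟨ m⊓n≤n _ _ ⟩
  costTwice (Y ◂ tower j Y) Y     ≡⟨ pair-costTwice-Y j Y ⟩
  suc (fib (3 + j))               ≤⟨ s≤s (cost-twice-away-≥ (tower j Y) (≢-sym Y≢Z)) ⟩
  suc (cost (Z ◂ Z ◂ tower j Y) Y) ∎
  where open ≤-Reasoning
... | inj₂ (inj₂ refl) = begin
  cost (X ◂ Y ◂ tower j Y) Z      ≡⟨ cost-away (Y ◂ tower j Y) X≢Z ⟩
  costOnce (Y ◂ tower j Y) X Z ⊓ _ ≤⟨ m⊓n≤m _ _ ⟩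
  costOnce (Y ◂ tower j Y) X Z    ≡⟨ pair-costOnce-Z j X≢Y X≢Z Y≢Z ⟩
  fib (2 + j)                     ≡⟨ pair-cost-Z j Y≢Z ⟨
  suc (cost (Z ◂ Z ◂ tower j Y) Z) ∎
  where open ≤-Reasoning

costTwice-step : ∀ {m} {s t : Conf m} {kZ} → Step s kZ t → ∀ P → costTwice s P ≤ suc (costTwice t P)
costTwice-step st P = s≤s (+-monoˡ-≤ _ (cost-step st P))

Direct : ∀ {m} → Conf m → Peg → Set
Direct [] P = ⊤
Direct (x ◂ s) P with x ≟ₚ P
... | yes _ = Direct s P
... | no _  = costOnce s x P < costTwice s P × Direct s (third x P)

Direct-here : ∀ {m} x {s : Conf m} → Direct s x → Direct (x ◂ s) x
Direct-here x d with x ≟ₚ x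
... | yes _   = d
... | no x≢x = ⊥-elim (x≢x refl)

Direct-away : ∀ {m} {x P} {s : Conf m} → x ≢ P → Direct (x ◂ s) P →
              costOnce s x P < costTwice s P × Direct s (third x P)
Direct-away {x = x} {P} x≢P d with x ≟ₚ P
... | yes x≡P = ⊥-elim (x≢P x≡P)
... | no _    = d

Direct-tower : ∀ m Y P → Direct (tower m Y) P
Direct-tower zero    Y P = tt
Direct-tower (suc m) Y P with Y ≟ₚ P
... | yes _   = Direct-tower m Y P
... | no Y≢P = tower-once<twice m Y≢P , Direct-tower m Y (third Y P)

cost-direct : ∀ {m} {x P} (s : Conf m) → x ≢ P → costOnce s x P < costTwice s P →
              cost (x ◂ s) P ≡ costOnce s x P
cost-direct s x≢P once<twice = trans (cost-away s x≢P) (m≤n⇒m⊓n≡m (<⇒≤ once<twice))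

directMove : ∀ {m} → Conf m → Peg → ℕ × Peg
directMove [] P = 0 , P
directMove {suc m} (x ◂ s) P with x ≟ₚ P
... | yes _ = directMove s P
... | no _ with cost s (third x P)
...   | zero  = m , P
...   | suc _ = directMove s (third x P)

-- a ⊓ b and a′ ⊓ b′ are the costs before and after a move, with a < b (directness) and
-- b ≤ 1 + b′ (costTwice-step).
module _ {a b a′ b′ : ℕ} (a<b : a < b) (b≤1+b′ : b ≤ suc b′) where

  tight-< : suc a′ ≡ a → a′ < b′
  tight-< refl = ≤-pred (≤-trans a<b b≤1+b′)

  tight-⊓ : suc (a′ ⊓ b′) ≡ a → suc a′ ≡ a
  tight-⊓ e with ⊓-sel a′ b′
  ... | inj₁ ⊓≡a′ = trans (cong suc (sym ⊓≡a′)) e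
  ... | inj₂ ⊓≡b′ = ⊥-elim (≤⇒≯ b≤1+b′ (subst (_< b) (trans (sym e) (cong suc ⊓≡b′)) a<b))

top-step : ∀ m {x P} → x ≢ P →
           ∃ λ t → Step (x ◂ tower m (third x P)) (m , P) t × suc (cost t P) ≡ fib (1 + m)
top-step zero    {P = P} x≢P = P ◂ [] , single x≢P , cong suc (cost-here P [])
top-step (suc j) {x} {P} x≢P =
  P ◂ P ◂ tower j (third x P) ,
  pair j (≢-third x P x≢P) x≢P (third-≢ x P x≢P) ,
  pair-cost-Z j (third-≢ x P x≢P)

direct-step : ∀ {m} (s : Conf m) P → Direct s P → 0 < cost s P →
              ∃ λ t → Step s (directMove s P) t × suc (cost t P) ≡ cost s P
direct-step [] P _ ()
direct-step {suc m} (x ◂ s) P d 0<c with x ≟ₚ P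
... | yes refl =
  let t , st , tight = direct-step s x d 0<c in x ◂ t , below x st , trans (cong suc (cost-here x t)) tight
... | no x≢P with cost s (third x P) in c≡
...   | suc c′ =
  let t , st , tight = direct-step s (third x P) (proj₂ d) (subst (0 <_) (sym c≡) (s≤s z≤n))
      one-less : suc (costOnce t x P) ≡ suc c′ + fib (1 + m)
      one-less = cong (_+ fib (1 + m)) (trans tight c≡)
      once<twice′ : costOnce t x P < costTwice t P
      once<twice′ = tight-< (proj₁ d) (costTwice-step st P) one-less
  in x ◂ t , below x st , (begin
    suc (cost (x ◂ t) P)                  ≡⟨ cong suc (cost-away t x≢P) ⟩
    suc (costOnce t x P ⊓ costTwice t P)  ≡⟨ cong suc (m≤n⇒m⊓n≡m (<⇒≤ once<twice′)) ⟩
    suc (costOnce t x P)                  ≡⟨ one-less ⟩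
    suc c′ + fib (1 + m)                  ≡⟨ m≤n⇒m⊓n≡m (<⇒≤ (proj₁ d)) ⟨
    (suc c′ + fib (1 + m)) ⊓ costTwice s P ∎)
  where open ≡-Reasoning
...   | zero with tower-of-cost-zero s (third x P) c≡
...     | refl = let t , st , tight = top-step m x≢P in
                 t , st , trans tight (sym (m≤n⇒m⊓n≡m (<⇒≤ (proj₁ d))))

pair-directMove : ∀ j {X Y Z} → X ≢ Y → X ≢ Z → Y ≢ Z →
                  directMove (X ◂ Y ◂ tower j Y) Z ≡ (suc j , Z)
pair-directMove j {X} {Y} {Z} X≢Y X≢Z Y≢Z with X ≟ₚ Z
... | yes X≡Z = ⊥-elim (X≢Z X≡Z)
... | no _ rewrite third-unique X Z Y X≢Z X≢Y (≢-sym Y≢Z) | cost-tower-here (suc j) Y = refl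

tight-step-direct : ∀ {m} {s t : Conf m} {kZ} → Step s kZ t → ∀ P → Direct s P →
                    suc (cost t P) ≡ cost s P → kZ ≡ directMove s P × Direct t P
tight-step-direct {suc m} (below {s = s} {t} x st) P d tight with x ≟ₚ P
... | yes _ = tight-step-direct st P d tight
... | no x≢P
  with tight-⊓ (proj₁ d) (costTwice-step st P) (trans tight (m≤n⇒m⊓n≡m (<⇒≤ (proj₁ d))))
...   | one-less with +-cancelʳ-≡ (fib (1 + m)) (suc (cost t (third x P))) (cost s (third x P)) one-less
...     | tightR rewrite sym tightR =
  let kZ≡ , dR = tight-step-direct st (third x P) (proj₂ d) tightR
  in kZ≡ , (tight-< (proj₁ d) (costTwice-step st P) one-less , dR)
tight-step-direct (single {X} {Z} _) P d tight with X ≟ₚ P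
... | yes _ = ⊥-elim (1+n≢0 tight)
... | no _ with tower-of-cost-zero (Z ◂ []) P (suc-injective tight)
...   | refl = refl , Direct-tower 1 P P
tight-step-direct (pair {X} {Y} {Z} j X≢Y X≢Z Y≢Z) P d tight with peg-cases X Y Z P X≢Y X≢Z Y≢Z
... | inj₁ refl = ⊥-elim (<⇒≢ (s≤s (<⇒≤ (pair-cost-X j X≢Y X≢Z))) (sym tight))
... | inj₂ (inj₁ refl) = ⊥-elim (<⇒≢ cost< (sym tight))
  where
  direct = proj₁ (Direct-away X≢Y d)
  cost< : cost (X ◂ Y ◂ tower j Y) Y < suc (cost (Z ◂ Z ◂ tower j Y) Y)
  cost< = begin-strict
    cost (X ◂ Y ◂ tower j Y) Y       ≡⟨ cost-direct (Y ◂ tower j Y) X≢Y direct ⟩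
    costOnce (Y ◂ tower j Y) X Y     <⟨ direct ⟩
    costTwice (Y ◂ tower j Y) Y      ≡⟨ pair-costTwice-Y j Y ⟩
    suc (fib (3 + j))                ≤⟨ s≤s (cost-twice-away-≥ (tower j Y) (≢-sym Y≢Z)) ⟩
    suc (cost (Z ◂ Z ◂ tower j Y) Y) ∎
    where open ≤-Reasoning
... | inj₂ (inj₂ refl) =
  sym (pair-directMove j X≢Y X≢Z Y≢Z) , Direct-here Z (Direct-here Z (Direct-tower j Y Z))

-- The peg of disk i + 1 (junk value pA outside Δ_m).
pegOf : ∀ {m} → Conf m → ℕ → Peg
pegOf [] _ = pA
pegOf {suc m} (x ◂ s) i with i <? m
... | yes _ = pegOf s i
... | no _  = x

pegOf-below : ∀ {m i} {x} {s : Conf m} → i < m → pegOf (x ◂ s) i ≡ pegOf s i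
pegOf-below {m} {i} i<m with i <? m
... | yes _   = refl
... | no i≮m = ⊥-elim (i≮m i<m)

pegOf-top : ∀ {m} x (s : Conf m) → pegOf (x ◂ s) m ≡ x
pegOf-top {m} _ _ with m <? m
... | yes m<m = ⊥-elim (<-irrefl refl m<m)
... | no _    = refl

pegOf-tower : ∀ {m i} Y → i < m → pegOf (tower m Y) i ≡ Y
pegOf-tower {suc m} Y i<1+m with m<1+n⇒m<n∨m≡n i<1+m
... | inj₁ i<m = trans (pegOf-below i<m) (pegOf-tower Y i<m)
... | inj₂ refl = pegOf-top Y (tower m Y)

Conf-ext : ∀ {m} {s t : Conf m} → (∀ {i} → i < m → pegOf s i ≡ pegOf t i) → s ≡ t
Conf-ext {s = []} {[]} _ = refl
Conf-ext {suc m} {x ◂ s} {y ◂ t} same = cong₂ _◂_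
  (trans (sym (pegOf-top x s)) (trans (same (n<1+n m)) (pegOf-top y t)))
  (Conf-ext λ i<m → trans (sym (pegOf-below i<m)) (trans (same (m<n⇒m<1+n i<m)) (pegOf-below i<m)))

fromPegs : ∀ m → (ℕ → Peg) → Conf m
fromPegs zero    f = []
fromPegs (suc m) f = f m ◂ fromPegs m f

pegOf-fromPegs : ∀ {m i} (f : ℕ → Peg) → i < m → pegOf (fromPegs m f) i ≡ f i
pegOf-fromPegs {suc m} f i<1+m with m<1+n⇒m<n∨m≡n i<1+m
... | inj₁ i<m = trans (pegOf-below i<m) (pegOf-fromPegs f i<m)
... | inj₂ refl = pegOf-top (f m) (fromPegs m f)

lookupℕ : ∀ {n} → Vec Peg n → ℕ → Peg
lookupℕ []       _       = pA
lookupℕ (x ∷ v) zero    = x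
lookupℕ (x ∷ v) (suc i) = lookupℕ v i

lookupℕ-toℕ : ∀ {n} (v : Vec Peg n) i → lookupℕ v (toℕ i) ≡ lookup v i
lookupℕ-toℕ (x ∷ v) fzero    = refl
lookupℕ-toℕ (x ∷ v) (fsuc i) = lookupℕ-toℕ v i

toConf : ∀ {n} → State n → Conf n
toConf {n} v = fromPegs n (lookupℕ v)

fromConf : ∀ {n} → Conf n → State n
fromConf u = tabulate (pegOf u ∘ toℕ)

pegOf-toConf : ∀ {n} (v : State n) i → pegOf (toConf v) (toℕ i) ≡ lookup v i
pegOf-toConf v i = trans (pegOf-fromPegs (lookupℕ v) (toℕ<n i)) (lookupℕ-toℕ v i)

∀ℕ< : ∀ {n} {Q : ℕ → Set} → (∀ (i : Fin n) → Q (toℕ i)) → ∀ {j} → j < n → Q j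
∀ℕ< {Q = Q} h j<n = subst Q (toℕ-fromℕ< j<n) (h (fromℕ< j<n))

toConf-fromConf : ∀ {n} (u : Conf n) → toConf (fromConf u) ≡ u
toConf-fromConf u =
  Conf-ext (∀ℕ< λ i → trans (pegOf-toConf (fromConf u) i) (lookup∘tabulate (pegOf u ∘ toℕ) i))

toConf-injective : ∀ {n} {v w : State n} → toConf v ≡ toConf w → v ≡ w
toConf-injective {v = v} {w} e = begin
  v                    ≡⟨ tabulate∘lookup v ⟨
  tabulate (lookup v)  ≡⟨ tabulate-cong same ⟩
  tabulate (lookup w)  ≡⟨ tabulate∘lookup w ⟩
  w                    ∎
  where
  open ≡-Reasoning
  same : ∀ i → lookup v i ≡ lookup w i
  same i = trans (sym (pegOf-toConf v i)) (trans (cong (λ u → pegOf u (toℕ i)) e) (pegOf-toConf w i))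

toConf-replicate : ∀ n P → toConf (replicate n P) ≡ tower n P
toConf-replicate n P = Conf-ext (∀ℕ< λ i →
  trans (pegOf-toConf (replicate n P) i) (trans (lookup-replicate i P) (sym (pegOf-tower P (toℕ<n i)))))

-- Defs.FibStep, read on configurations with disks indexed from 0.
record IsMove {m} (s : Conf m) (k : ℕ) (X Y Z : Peg) (t : Conf m) : Set where
  field
    k<m          : k < m
    X≢Y          : X ≢ Y
    X≢Z          : X ≢ Z
    Y≢Z          : Y ≢ Z
    k-on-X       : pegOf s k ≡ X
    X-above-k    : ∀ {j} → j < m → pegOf s j ≡ X → k ≤ j
    below-k-on-Y : ∀ {j} → j < k → pegOf s j ≡ Y
    Z-above-k    : ∀ {j} → j < m → pegOf s j ≡ Z → k < j
    moved        : ∀ {j} → j < m → j ≡ k ⊎ suc j ≡ k → pegOf t j ≡ Z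
    unmoved      : ∀ {j} → j < m → j ≢ k → suc j ≢ k → pegOf t j ≡ pegOf s j

FibStep⇒IsMove : ∀ {n} {v w : State n} {k X Y Z} → FibStep v (move k X Y Z) w →
                 IsMove (toConf v) (toℕ k) X Y Z (toConf w)
FibStep⇒IsMove {v = v} {w} {k} {Y = Y}
  (X≢Y , X≢Z , Y≢Z , k-on-X , X-above-k , below-k-on-Y , Z-above-k , moved , unmoved) =
  record
    { k<m          = toℕ<n k
    ; X≢Y          = X≢Y
    ; X≢Z          = X≢Z
    ; Y≢Z          = Y≢Z
    ; k-on-X       = trans (pegOf-toConf v k) k-on-X
    ; X-above-k    = ∀ℕ< λ i on-X → X-above-k i (trans (sym (pegOf-toConf v i)) on-X)
    ; below-k-on-Y = λ j<k → ∀ℕ< {Q = λ j → j < toℕ k → pegOf (toConf v) j ≡ Y}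
                       (λ i i<k → trans (pegOf-toConf v i) (below-k-on-Y i i<k)) (<-trans j<k (toℕ<n k)) j<k
    ; Z-above-k    = ∀ℕ< λ i on-Z → Z-above-k i (trans (sym (pegOf-toConf v i)) on-Z)
    ; moved        = ∀ℕ< λ i k-or-k−1 → trans (pegOf-toConf w i) (moved i k-or-k−1)
    ; unmoved      = ∀ℕ< λ i i≢k 1+i≢k →
                       trans (pegOf-toConf w i) (trans (unmoved i i≢k 1+i≢k) (sym (pegOf-toConf v i)))
    }

IsMove⇒FibStep : ∀ {n} {v : State n} {u k X Y Z} (k<n : k < n) → IsMove (toConf v) k X Y Z u →
                 FibStep v (move (fromℕ< k<n) X Y Z) (fromConf u)
IsMove⇒FibStep {v = v} {u} k<n im rewrite toℕ-fromℕ< k<n =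
  X≢Y , X≢Z , Y≢Z ,
  trans (sym (pegOf-toConf v (fromℕ< k<n))) (trans (cong (pegOf (toConf v)) (toℕ-fromℕ< k<n)) k-on-X) ,
  (λ i on-X → X-above-k (toℕ<n i) (trans (pegOf-toConf v i) on-X)) ,
  (λ i i<k → trans (sym (pegOf-toConf v i)) (below-k-on-Y i<k)) ,
  (λ i on-Z → Z-above-k (toℕ<n i) (trans (pegOf-toConf v i) on-Z)) ,
  (λ i k-or-k−1 → trans (lookup∘tabulate (pegOf u ∘ toℕ) i) (moved (toℕ<n i) k-or-k−1)) ,
  (λ i i≢k 1+i≢k → trans (lookup∘tabulate (pegOf u ∘ toℕ) i)
                      (trans (unmoved (toℕ<n i) i≢k 1+i≢k) (pegOf-toConf v i)))
  where open IsMove im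

<-suc-elim : ∀ {m} (Q : ℕ → Set) → (∀ {j} → j < m → Q j) → Q m → ∀ {j} → j < suc m → Q j
<-suc-elim Q below-m at-m j<1+m with m<1+n⇒m<n∨m≡n j<1+m
... | inj₁ j<m = below-m j<m
... | inj₂ refl = at-m

IsMove-extend : ∀ {m} x {s t : Conf m} {k X Y Z} → IsMove s k X Y Z t → IsMove (x ◂ s) k X Y Z (x ◂ t)
IsMove-extend {m} x {s} {t} {k} {X} {Y} {Z} im = record
  { k<m          = m<n⇒m<1+n k<m
  ; X≢Y          = X≢Y
  ; X≢Z          = X≢Z
  ; Y≢Z          = Y≢Z
  ; k-on-X       = trans (pegOf-below k<m) k-on-X
  ; X-above-k    = <-suc-elim (λ j → pegOf (x ◂ s) j ≡ X → k ≤ j)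
                     (λ j<m on-X → X-above-k j<m (trans (sym (pegOf-below j<m)) on-X)) (λ _ → <⇒≤ k<m)
  ; below-k-on-Y = λ j<k → trans (pegOf-below (<-trans j<k k<m)) (below-k-on-Y j<k)
  ; Z-above-k    = <-suc-elim (λ j → pegOf (x ◂ s) j ≡ Z → k < j)
                     (λ j<m on-Z → Z-above-k j<m (trans (sym (pegOf-below j<m)) on-Z)) (λ _ → k<m)
  ; moved        = <-suc-elim (λ j → j ≡ k ⊎ suc j ≡ k → pegOf (x ◂ t) j ≡ Z)
                     (λ j<m k-or-k−1 → trans (pegOf-below j<m) (moved j<m k-or-k−1))
                     λ { (inj₁ m≡k)   → ⊥-elim (>⇒≢ k<m m≡k)
                       ; (inj₂ 1+m≡k) → ⊥-elim (>⇒≢ (m<n⇒m<1+n k<m) 1+m≡k) }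
  ; unmoved      = <-suc-elim (λ j → j ≢ k → suc j ≢ k → pegOf (x ◂ t) j ≡ pegOf (x ◂ s) j)
                     (λ j<m j≢k 1+j≢k →
                        trans (pegOf-below j<m) (trans (unmoved j<m j≢k 1+j≢k) (sym (pegOf-below j<m))))
                     (λ _ _ → trans (pegOf-top x t) (sym (pegOf-top x s)))
  }
  where open IsMove im

IsMove-restrict : ∀ {m} {x y} {s t : Conf m} {k X Y Z} → IsMove (x ◂ s) k X Y Z (y ◂ t) → k < m →
                  y ≡ x × IsMove s k X Y Z t
IsMove-restrict {m} {x} {y} {s} {t} im k<m =
  trans (sym (pegOf-top y t)) (trans (unmoved (n<1+n m) (>⇒≢ k<m) (>⇒≢ (m<n⇒m<1+n k<m))) (pegOf-top x s)) ,
  record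
    { k<m          = k<m
    ; X≢Y          = X≢Y
    ; X≢Z          = X≢Z
    ; Y≢Z          = Y≢Z
    ; k-on-X       = trans (sym (pegOf-below k<m)) k-on-X
    ; X-above-k    = λ j<m on-X → X-above-k (m<n⇒m<1+n j<m) (trans (pegOf-below j<m) on-X)
    ; below-k-on-Y = λ j<k → trans (sym (pegOf-below (<-trans j<k k<m))) (below-k-on-Y j<k)
    ; Z-above-k    = λ j<m on-Z → Z-above-k (m<n⇒m<1+n j<m) (trans (pegOf-below j<m) on-Z)
    ; moved        = λ j<m k-or-k−1 → trans (sym (pegOf-below j<m)) (moved (m<n⇒m<1+n j<m) k-or-k−1)
    ; unmoved      = λ j<m j≢k 1+j≢k →
        trans (sym (pegOf-below j<m)) (trans (unmoved (m<n⇒m<1+n j<m) j≢k 1+j≢k) (pegOf-below j<m))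
    }
  where open IsMove im hiding (k<m)

Step⇒IsMove : ∀ {m} {s t : Conf m} {k Z} → Step s (k , Z) t → ∃₂ λ X Y → IsMove s k X Y Z t
Step⇒IsMove (below x st) = let X , Y , im = Step⇒IsMove st in X , Y , IsMove-extend x im
Step⇒IsMove (single {X} {Z} X≢Z) = X , third X Z , record
  { k<m          = s≤s z≤n
  ; X≢Y          = ≢-third X Z X≢Z
  ; X≢Z          = X≢Z
  ; Y≢Z          = third-≢ X Z X≢Z
  ; k-on-X       = refl
  ; X-above-k    = λ _ _ → z≤n
  ; below-k-on-Y = λ ()
  ; Z-above-k    = λ { {zero} _ X≡Z → ⊥-elim (X≢Z X≡Z) ; {suc _} (s≤s ()) }
  ; moved        = λ { {zero} _ _ → refl ; {suc _} (s≤s ()) }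
  ; unmoved      = λ { {zero} _ 0≢0 _ → ⊥-elim (0≢0 refl) ; {suc _} (s≤s ()) }
  }
Step⇒IsMove (pair {X} {Y} {Z} j X≢Y X≢Z Y≢Z) = X , Y , record
  { k<m          = n<1+n (suc j)
  ; X≢Y          = X≢Y
  ; X≢Z          = X≢Z
  ; Y≢Z          = Y≢Z
  ; k-on-X       = pegOf-top X (Y ◂ tower j Y)
  ; X-above-k    = <-suc-elim (λ i → pegOf s i ≡ X → suc j ≤ i)
                     (λ i<1+j on-X → ⊥-elim (X≢Y (trans (sym on-X) (on-Y i<1+j)))) (λ _ → ≤-refl)
  ; below-k-on-Y = on-Y
  ; Z-above-k    = <-suc-elim (λ i → pegOf s i ≡ Z → suc j < i)
                     (λ i<1+j on-Z → ⊥-elim (Y≢Z (trans (sym (on-Y i<1+j)) on-Z)))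
                     (λ on-Z → ⊥-elim (X≢Z (trans (sym (pegOf-top X (Y ◂ tower j Y))) on-Z)))
  ; moved        = λ { _ (inj₁ refl) → pegOf-top Z (Z ◂ tower j Y)
                     ; _ (inj₂ refl) → trans (pegOf-below (n<1+n j)) (pegOf-top Z (tower j Y)) }
  ; unmoved      = λ i<2+j i≢1+j 1+i≢1+j → let i<j = below-j i<2+j i≢1+j 1+i≢1+j in
                     trans (pegOf-below (m<n⇒m<1+n i<j)) (trans (pegOf-below i<j)
                       (trans (pegOf-tower Y i<j) (sym (on-Y (m<n⇒m<1+n i<j)))))
  }
  where
  s = X ◂ Y ◂ tower j Y
  on-Y : ∀ {i} → i < suc j → pegOf s i ≡ Y
  on-Y i<1+j = trans (pegOf-below i<1+j) (pegOf-tower Y i<1+j)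
  below-j : ∀ {i} → i < 2 + j → i ≢ suc j → suc i ≢ suc j → i < j
  below-j i<2+j i≢1+j 1+i≢1+j with m<1+n⇒m<n∨m≡n i<2+j
  ... | inj₂ i≡1+j = ⊥-elim (i≢1+j i≡1+j)
  ... | inj₁ i<1+j with m<1+n⇒m<n∨m≡n i<1+j
  ...   | inj₁ i<j = i<j
  ...   | inj₂ i≡j = ⊥-elim (1+i≢1+j (cong suc i≡j))

IsMove-top-shape : ∀ {m} {x y} {s t : Conf m} {X Y Z} → IsMove (x ◂ s) m X Y Z (y ◂ t) →
                   x ≡ X × y ≡ Z × s ≡ tower m Y
IsMove-top-shape {m} {x} {y} {s} {t} {Y = Y} im =
  trans (sym (pegOf-top x s)) k-on-X ,
  trans (sym (pegOf-top y t)) (moved (n<1+n m) (inj₁ refl)) ,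
  Conf-ext (λ i<m → trans (sym (pegOf-below i<m)) (trans (below-k-on-Y i<m) (sym (pegOf-tower Y i<m))))
  where open IsMove im

IsMove-top⇒Step : ∀ {m} {x y} {s t : Conf m} {X Y Z} → IsMove (x ◂ s) m X Y Z (y ◂ t) →
                  Step (x ◂ s) (m , Z) (y ◂ t)
IsMove-top⇒Step {zero} {t = []} im with IsMove-top-shape im
... | refl , refl , refl = single (IsMove.X≢Z im)
IsMove-top⇒Step {suc j} {x} {y} {s} {z ◂ t} {X} {Y} {Z} im with IsMove-top-shape im | z≡Z | t≡tower
  where
  open IsMove im
  z≡Z : z ≡ Z
  z≡Z = trans (sym (pegOf-top z t))
          (trans (sym (pegOf-below (n<1+n j))) (moved (m<n⇒m<1+n (n<1+n j)) (inj₂ refl)))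
  t≡tower : t ≡ tower j Y
  t≡tower = Conf-ext λ {i} i<j → let i<1+j = m<n⇒m<1+n i<j in begin
    pegOf t i              ≡⟨ pegOf-below i<j ⟨
    pegOf (z ◂ t) i        ≡⟨ pegOf-below i<1+j ⟨
    pegOf (y ◂ z ◂ t) i    ≡⟨ unmoved (m<n⇒m<1+n i<1+j) (<⇒≢ i<1+j) (<⇒≢ (s≤s i<j)) ⟩
    pegOf (x ◂ s) i        ≡⟨ below-k-on-Y i<1+j ⟩
    Y                      ≡⟨ pegOf-tower Y i<j ⟨
    pegOf (tower j Y) i    ∎
    where open ≡-Reasoning
... | refl , refl , refl | refl | refl = pair j X≢Y X≢Z Y≢Z
  where open IsMove im

IsMove⇒Step : ∀ {m} {s t : Conf m} {k X Y Z} → IsMove s k X Y Z t → Step s (k , Z) t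
IsMove⇒Step {zero} im = ⊥-elim (n≮0 (IsMove.k<m im))
IsMove⇒Step {suc m} {x ◂ s} {y ◂ t} im with m<1+n⇒m<n∨m≡n (IsMove.k<m im)
... | inj₂ refl = IsMove-top⇒Step im
... | inj₁ k<m with IsMove-restrict im k<m
...   | refl , im′ = below x (IsMove⇒Step im′)

FibStep⇒Step : ∀ {n} {v w : State n} {k X Y Z} → FibStep v (move k X Y Z) w →
               Step (toConf v) (toℕ k , Z) (toConf w)
FibStep⇒Step {v = v} {w} fs = IsMove⇒Step (FibStep⇒IsMove {v = v} {w} fs)

FibStep-deterministic : ∀ {n} {v w w′ : State n} {k X Y Z k′ X′ Y′ Z′} →
  FibStep v (move k X Y Z) w → FibStep v (move k′ X′ Y′ Z′) w′ → (toℕ k , Z) ≡ (toℕ k′ , Z′) →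
  move k X Y Z ≡ move k′ X′ Y′ Z′ × w ≡ w′
FibStep-deterministic {w = w} {w′} {k} (X≢Y , X≢Z , Y≢Z , k-on-X , _ , _ , _ , moved , unmoved)
  (X′≢Y′ , X′≢Z′ , Y′≢Z′ , k-on-X′ , _ , _ , _ , moved′ , unmoved′) same
  with toℕ-injective (,-injectiveˡ same) | ,-injectiveʳ same
... | refl | refl with trans (sym k-on-X) k-on-X′
...   | refl
  with trans (sym (third-unique _ _ _ X≢Z X≢Y (≢-sym Y≢Z))) (third-unique _ _ _ X′≢Z′ X′≢Y′ (≢-sym Y′≢Z′))
...     | refl = refl , trans (sym (tabulate∘lookup w)) (trans (tabulate-cong same-peg) (tabulate∘lookup w′))
  where
  same-peg : ∀ j → lookup w j ≡ lookup w′ j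
  same-peg j with toℕ j ≟ toℕ k | suc (toℕ j) ≟ toℕ k
  ... | yes j≡k | _         = trans (moved j (inj₁ j≡k)) (sym (moved′ j (inj₁ j≡k)))
  ... | no _    | yes 1+j≡k = trans (moved j (inj₂ 1+j≡k)) (sym (moved′ j (inj₂ 1+j≡k)))
  ... | no j≢k  | no 1+j≢k  = trans (unmoved j j≢k 1+j≢k) (sym (unmoved′ j j≢k 1+j≢k))

cost-reaches : ∀ {n} {v w : State n} ms P → Reaches v ms w → cost (toConf v) P ≤ length ms + cost (toConf w) P
cost-reaches []                   P refl          = ≤-refl
cost-reaches {v = v} (move k X Y Z ∷ ms) P (u , fs , r) =
  ≤-trans (cost-step (FibStep⇒Step {v = v} {u} fs) P) (s≤s (cost-reaches ms P r))

cost-≤-solution : ∀ {n} {v : State n} ms P → Reaches v ms (replicate n P) → cost (toConf v) P ≤ length ms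
cost-≤-solution {n} {v} ms P r = begin
  cost (toConf v) P                            ≤⟨ cost-reaches ms P r ⟩
  length ms + cost (toConf (replicate n P)) P  ≡⟨ cong (λ u → length ms + cost u P) (toConf-replicate n P) ⟩
  length ms + cost (tower n P) P               ≡⟨ cong (length ms +_) (cost-tower-here n P) ⟩
  length ms + 0                                ≡⟨ +-identityʳ _ ⟩
  length ms                                    ∎
  where open ≤-Reasoning

tight-fibStep : ∀ {n} {v w : State n} {k X Y Z} P → Direct (toConf v) P → FibStep v (move k X Y Z) w →
                suc (cost (toConf w) P) ≡ cost (toConf v) P →
                (toℕ k , Z) ≡ directMove (toConf v) P × Direct (toConf w) P
tight-fibStep {v = v} {w} P d fs = tight-step-direct (FibStep⇒Step {v = v} {w} fs) P d

direct-fibStep : ∀ {n} (v : State n) P → Direct (toConf v) P → 0 < cost (toConf v) P →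
                 ∃₂ λ mv w → FibStep v mv w × suc (cost (toConf w) P) ≡ cost (toConf v) P
direct-fibStep v P d 0<c with direct-step (toConf v) P d 0<c
... | u , st , tight with Step⇒IsMove st
...   | X , Y , im =
  move (fromℕ< (IsMove.k<m im)) X Y _ , fromConf u , IsMove⇒FibStep {v = v} {u} (IsMove.k<m im) im ,
  subst (λ u′ → suc (cost u′ P) ≡ cost (toConf v) P) (sym (toConf-fromConf u)) tight

solution-step-tight : ∀ {n} {v w : State n} {k X Y Z} ms P → FibStep v (move k X Y Z) w →
                      Reaches w ms (replicate n P) → cost (toConf v) P ≡ suc (length ms) →
                      suc (cost (toConf w) P) ≡ cost (toConf v) P
solution-step-tight {v = v} {w} ms P fs r c≡ =
  ≤-antisym (subst (suc (cost (toConf w) P) ≤_) (sym c≡) (s≤s (cost-≤-solution ms P r)))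
            (cost-step (FibStep⇒Step {v = v} {w} fs) P)

solve : ∀ {n} L (v : State n) P → Direct (toConf v) P → cost (toConf v) P ≡ L →
        ∃ λ ms → Reaches v ms (replicate n P) × length ms ≡ L
solve {n} zero v P _ c≡0 =
  [] , toConf-injective (trans (tower-of-cost-zero (toConf v) P c≡0) (sym (toConf-replicate n P))) , refl
solve (suc L) v P d c≡ with direct-fibStep v P d (subst (0 <_) (sym c≡) (s≤s z≤n))
... | move k X Y Z , w , fs , tight =
  let ms , r , len = solve L w P (proj₂ (tight-fibStep {v = v} {w} P d fs tight)) (suc-injective (trans tight c≡))
  in move k X Y Z ∷ ms , (w , fs , r) , cong suc len

solutions-unique : ∀ {n} (v : State n) P ms ms′ → Direct (toConf v) P → cost (toConf v) P ≡ length ms →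
                   Reaches v ms (replicate n P) → Reaches v ms′ (replicate n P) →
                   length ms′ ≡ length ms → ms′ ≡ ms
solutions-unique v P [] [] _ _ _ _ _ = refl
solutions-unique v P (move k X Y Z ∷ ms) (move k′ X′ Y′ Z′ ∷ ms′) d c≡ (w , fs , r) (w′ , fs′ , r′) len
  with solution-step-tight {v = v} {w} ms P fs r c≡
     | solution-step-tight {v = v} {w′} ms′ P fs′ r′ (trans c≡ (sym len))
... | tight | tight′ with tight-fibStep {v = v} {w} P d fs tight | tight-fibStep {v = v} {w′} P d fs′ tight′
...   | dm , dw | dm′ , _ with FibStep-deterministic {v = v} {w′} {w} fs′ fs (trans dm′ (sym dm))
...     | refl , refl =
  cong (move k X Y Z ∷_)
       (solutions-unique w P ms ms′ dw (suc-injective (trans tight c≡)) r r′ (suc-injective len))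

theorem2p2 : (n : ℕ) →
    Σ (List (Move n)) (λ ms →
      Reaches (start n) ms (goal n) ×
      length ms ≡ fib (n + 2) ∸ 1 ×
      (∀ (ms′ : List (Move n)) → Reaches (start n) ms′ (goal n) → length ms ≤ length ms′) ×
      (∀ (ms′ : List (Move n)) → Reaches (start n) ms′ (goal n) → length ms′ ≡ length ms → ms′ ≡ ms))
theorem2p2 n =
  ms , r , len ,
  (λ ms′ r′ → subst (_≤ length ms′) (trans c₀ (sym len)) (cost-≤-solution ms′ pC r′)) ,
  (λ ms′ r′ len′ → solutions-unique (start n) pC ms ms′ d₀ (trans c₀ (sym len)) r r′ len′)
  where
  start-is-tower : toConf (start n) ≡ tower n pA
  start-is-tower = toConf-replicate n pA
  c₀ : cost (toConf (start n)) pC ≡ fib (n + 2) ∸ 1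
  c₀ = begin
    cost (toConf (start n)) pC      ≡⟨ cong (λ u → cost u pC) start-is-tower ⟩
    suc (cost (tower n pA) pC) ∸ 1  ≡⟨ cong (_∸ 1) (cost-tower-away n (λ ())) ⟩
    fib (2 + n) ∸ 1                 ≡⟨ cong (λ i → fib i ∸ 1) (+-comm 2 n) ⟩
    fib (n + 2) ∸ 1                 ∎
    where open ≡-Reasoning
  d₀ : Direct (toConf (start n)) pC
  d₀ = subst (λ u → Direct u pC) (sym start-is-tower) (Direct-tower n pA pC)
  solution = solve (fib (n + 2) ∸ 1) (start n) pC d₀ c₀
  ms = proj₁ solution
  r = proj₁ (proj₂ solution)
  len = proj₂ (proj₂ solution)
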